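{- Let $\{z_n\}_{n\ge0}$ be a sequence of positive real numbers satisfying $$(\alpha_1n+\alpha_0)z_{n+1}=(\beta_1n+\beta_0)z_n-(\gamma_1n+\gamma_0)z_{n-1}\quad(n\ge1),$$ where $\alpha_1n+\alpha_0$, $\beta_1n+\beta_0$, $\gamma_1n+\gamma_0$ are positive for all $n\ge1$. Let $$A=\begin{vmatrix}\beta_0&\beta_1\\ \gamma_0&\gamma_1\end{vmatrix},\quad B=\begin{vmatrix}\gamma_0&\gamma_1\\ \alpha_0&\alpha_1\end{vmatrix},\quad C=\begin{vmatrix}\alpha_0&\alpha_1\\ \beta_0&\beta_1\end{vmatrix}.$$ Suppose $z_0z_2\ge z_1^2$. Then $\{z_n\}_{n\ge0}$ is log-convex if one of the following holds: (i) $B\ge0$ and $C\ge0$; (ii) $B<0$, $C>0$, $AC\ge B^2$ and $z_0B+z_1C\ge0$; (iii) $B>0$, $C<0$, $AC\le B^2$ and $z_0B+z_1C\ge0$.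
   Context: A sequence $\{z_n\}$ of positive numbers is log-convex if $z_{k-1}z_{k+1}\ge z_k^2$ for all $k\ge1$. -}

module Defs where

open import Level using (Level; _⊔_) renaming (suc to lsuc)
open import Data.Nat using (ℕ; zero; suc)
open import Data.Product using (∃; _×_)
open import Relation.Nullary using (¬_)
open import Relation.Binary using (Rel; IsTotalOrder)
open import Algebra.Bundles using (CommutativeRing)

-- The real numbers are the intended instance (stdlib has no reals).
record OrderedField (c ℓ₁ ℓ₂ : Level) : Set (lsuc (c ⊔ ℓ₁ ⊔ ℓ₂)) where
  field
    commutativeRing : CommutativeRing c ℓ₁
  open CommutativeRing commutativeRing public
  infix 4 _≤_ _<_
  field
    _≤_          : Rel Carrier ℓ₂
    isTotalOrder : IsTotalOrder _≈_ _≤_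
    +-mono-≤     : ∀ {a b} c → a ≤ b → (a + c) ≤ (b + c)
    *-nonneg     : ∀ {a b} → 0# ≤ a → 0# ≤ b → 0# ≤ (a * b)
    0≉1          : ¬ (0# ≈ 1#)
    inverse      : ∀ a → ¬ (a ≈ 0#) → ∃ λ b → (a * b) ≈ 1#

  _<_ : Rel Carrier (ℓ₁ ⊔ ℓ₂)
  a < b = (a ≤ b) × ¬ (a ≈ b)

  fromℕ : ℕ → Carrier
  fromℕ zero    = 0#
  fromℕ (suc n) = 1# + fromℕ n

  LogConvex : (ℕ → Carrier) → Set ℓ₂
  LogConvex z = ∀ m → (z (suc m) * z (suc m)) ≤ (z m * z (suc (suc m)))

-- Write Δ m = z m z (m+2) − z (m+1)² (the log-convexity gap at n = m+1) and I m = z m B + z (m+1) C,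
-- and a m, b m, c m for the coefficients at n = m+1. Substituting the recurrence gives
--   a m a (m+1) Δ (m+1) = z (m+2) I m + a m c (m+1) Δ m,
-- because the Casoratians a m b (m+1) − a (m+1) b m and c m a (m+1) − c (m+1) a m of linear
-- coefficients are the constants C and B. So Δ stays nonnegative as long as I does. For I,
--   z m I (m+1) = z (m+1) I m + C Δ m,
-- which settles C ≥ 0; when instead B > 0 ≥ C, the relation a m A + b m B + c m C = 0 gives
--   B a m I (m+1) = a m z (m+1) (B² − AC) − C c m I m.
-- Hence Δ m ≥ 0 and I m ≥ 0 propagate together by induction from m = 0.
module Submission where

open import Defs
open import Level using (Level)
open import Algebra.Bundles using (CommutativeRing)
open import Data.Nat as ℕ using (ℕ; zero; suc)
import Data.Nat.Properties as ℕ
open import Data.Integer as ℤ using (ℤ; +_; -[1+_]; _⊖_)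
import Data.Integer.Properties as ℤ
open import Data.Sign as Sign using (Sign)
open import Data.Maybe using (Maybe; just; nothing)
open import Data.Product using (Σ; _×_; _,_; proj₁; proj₂)
open import Data.Sum using (_⊎_; inj₁; inj₂)
open import Relation.Nullary using (yes; no)
open import Function using (case_of_)
open import Relation.Binary using (IsTotalOrder)
import Relation.Binary.PropositionalEquality as ≡
open import Algebra.Solver.Ring.AlmostCommutativeRing
  using (_-Raw-AlmostCommutative⟶_; fromCommutativeRing)
import Algebra.Solver.Ring

-- Integer rather than ring coefficients, so that normal forms cancel definitionally.
module IntegerCoefficientSolver {c ℓ : Level} (R : CommutativeRing c ℓ) where
  open CommutativeRing R
  open import Algebra.Properties.Ring ring using (-‿distribˡ-*; -‿distribʳ-*)
  open import Algebra.Properties.AbelianGroup +-abelianGroup using (⁻¹-∙-comm)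
  open import Algebra.Properties.Group +-group using (⁻¹-involutive; ε⁻¹≈ε)
  open import Algebra.Properties.Semiring.Mult semiring using (×-homo-+; ×1-homo-*) renaming (_×_ to _·_)
  open import Relation.Binary.Reasoning.Setoid setoid

  ⟦_⟧ℕ : ℕ → Carrier
  ⟦ n ⟧ℕ = n · 1#

  ⟦_⟧ : ℤ → Carrier
  ⟦ + n ⟧      = ⟦ n ⟧ℕ
  ⟦ -[1+ n ] ⟧ = - ⟦ suc n ⟧ℕ

  ⟦⊖⟧ : ∀ m n → ⟦ m ⊖ n ⟧ ≈ ⟦ m ⟧ℕ - ⟦ n ⟧ℕ
  ⟦⊖⟧ m       zero    = sym (trans (+-congˡ ε⁻¹≈ε) (+-identityʳ ⟦ m ⟧ℕ))
  ⟦⊖⟧ zero    (suc n) = sym (+-identityˡ _)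
  ⟦⊖⟧ (suc m) (suc n) = begin
    ⟦ suc m ⊖ suc n ⟧                 ≡⟨ ≡.cong ⟦_⟧ (ℤ.[1+m]⊖[1+n]≡m⊖n m n) ⟩
    ⟦ m ⊖ n ⟧                         ≈⟨ ⟦⊖⟧ m n ⟩
    ⟦ m ⟧ℕ - ⟦ n ⟧ℕ                   ≈⟨ cancel-1 ⟨
    (1# + ⟦ m ⟧ℕ) - (1# + ⟦ n ⟧ℕ)     ∎
    where
    cancel-1 : (1# + ⟦ m ⟧ℕ) - (1# + ⟦ n ⟧ℕ) ≈ ⟦ m ⟧ℕ - ⟦ n ⟧ℕ
    cancel-1 = begin
      (1# + ⟦ m ⟧ℕ) + - (1# + ⟦ n ⟧ℕ)     ≈⟨ +-cong (+-comm 1# _) (sym (⁻¹-∙-comm 1# _)) ⟩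
      (⟦ m ⟧ℕ + 1#) + (- 1# + - ⟦ n ⟧ℕ)   ≈⟨ +-assoc _ 1# _ ⟩
      ⟦ m ⟧ℕ + (1# + (- 1# + - ⟦ n ⟧ℕ))   ≈⟨ +-congˡ (+-assoc 1# (- 1#) _) ⟨
      ⟦ m ⟧ℕ + ((1# - 1#) + - ⟦ n ⟧ℕ)     ≈⟨ +-congˡ (+-congʳ (-‿inverseʳ 1#)) ⟩
      ⟦ m ⟧ℕ + (0# + - ⟦ n ⟧ℕ)            ≈⟨ +-congˡ (+-identityˡ _) ⟩
      ⟦ m ⟧ℕ - ⟦ n ⟧ℕ                     ∎

  ⟦+⟧ : ∀ i j → ⟦ i ℤ.+ j ⟧ ≈ ⟦ i ⟧ + ⟦ j ⟧
  ⟦+⟧ -[1+ m ] -[1+ n ] = begin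
    - ⟦ suc (suc (m ℕ.+ n)) ⟧ℕ      ≡⟨ ≡.cong (λ k → - ⟦ suc k ⟧ℕ) (ℕ.+-suc m n) ⟨
    - ⟦ suc m ℕ.+ suc n ⟧ℕ          ≈⟨ -‿cong (×-homo-+ 1# (suc m) (suc n)) ⟩
    - (⟦ suc m ⟧ℕ + ⟦ suc n ⟧ℕ)     ≈⟨ ⁻¹-∙-comm _ _ ⟨
    - ⟦ suc m ⟧ℕ + - ⟦ suc n ⟧ℕ     ∎
  ⟦+⟧ -[1+ m ] (+ n)    = trans (⟦⊖⟧ n (suc m)) (+-comm _ _)
  ⟦+⟧ (+ m)    -[1+ n ] = ⟦⊖⟧ m (suc n)
  ⟦+⟧ (+ m)    (+ n)    = ×-homo-+ 1# m n

  ⟦-⟧ : ∀ i → ⟦ ℤ.- i ⟧ ≈ - ⟦ i ⟧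
  ⟦-⟧ -[1+ n ]    = sym (⁻¹-involutive _)
  ⟦-⟧ (+ zero)    = sym ε⁻¹≈ε
  ⟦-⟧ (+ suc n)   = refl

  signed : Sign → Carrier → Carrier
  signed Sign.+ x = x
  signed Sign.- x = - x

  signed-cong : ∀ s {x y} → x ≈ y → signed s x ≈ signed s y
  signed-cong Sign.+ = λ x≈y → x≈y
  signed-cong Sign.- = -‿cong

  signed-* : ∀ s t x y → signed (s Sign.* t) (x * y) ≈ signed s x * signed t y
  signed-* Sign.+ Sign.+ x y = refl
  signed-* Sign.+ Sign.- x y = -‿distribʳ-* x y
  signed-* Sign.- Sign.+ x y = -‿distribˡ-* x y
  signed-* Sign.- Sign.- x y = begin
    x * y          ≈⟨ ⁻¹-involutive _ ⟨
    - - (x * y)    ≈⟨ -‿cong (-‿distribˡ-* x y) ⟩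
    - (- x * y)    ≈⟨ -‿distribʳ-* (- x) y ⟩
    - x * - y      ∎

  ⟦◃⟧ : ∀ s n → ⟦ s ℤ.◃ n ⟧ ≈ signed s ⟦ n ⟧ℕ
  ⟦◃⟧ Sign.+ zero    = refl
  ⟦◃⟧ Sign.- zero    = sym ε⁻¹≈ε
  ⟦◃⟧ Sign.+ (suc n) = refl
  ⟦◃⟧ Sign.- (suc n) = refl

  ⟦signAbs⟧ : ∀ i → ⟦ i ⟧ ≈ signed (ℤ.sign i) ⟦ ℤ.∣ i ∣ ⟧ℕ
  ⟦signAbs⟧ (+ n)    = refl
  ⟦signAbs⟧ -[1+ n ] = refl

  ⟦*⟧ : ∀ i j → ⟦ i ℤ.* j ⟧ ≈ ⟦ i ⟧ * ⟦ j ⟧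
  ⟦*⟧ i j = begin
    ⟦ s ℤ.◃ (∣i∣ ℕ.* ∣j∣) ⟧                                ≈⟨ ⟦◃⟧ s (∣i∣ ℕ.* ∣j∣) ⟩
    signed s ⟦ ∣i∣ ℕ.* ∣j∣ ⟧ℕ                              ≈⟨ signed-cong s (×1-homo-* ∣i∣ ∣j∣) ⟩
    signed s (⟦ ∣i∣ ⟧ℕ * ⟦ ∣j∣ ⟧ℕ)                         ≈⟨ signed-* (ℤ.sign i) (ℤ.sign j) _ _ ⟩
    signed (ℤ.sign i) ⟦ ∣i∣ ⟧ℕ * signed (ℤ.sign j) ⟦ ∣j∣ ⟧ℕ ≈⟨ *-cong (⟦signAbs⟧ i) (⟦signAbs⟧ j) ⟨
    ⟦ i ⟧ * ⟦ j ⟧                                          ∎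
    where
    s : Sign
    s = ℤ.sign i Sign.* ℤ.sign j
    ∣i∣ ∣j∣ : ℕ
    ∣i∣ = ℤ.∣ i ∣
    ∣j∣ = ℤ.∣ j ∣

  homomorphism : ℤ.+-*-rawRing -Raw-AlmostCommutative⟶ fromCommutativeRing R
  homomorphism = record
    { ⟦_⟧    = ⟦_⟧
    ; +-homo = ⟦+⟧
    ; *-homo = ⟦*⟧
    ; -‿homo = ⟦-⟧
    ; 0-homo = refl
    ; 1-homo = +-identityʳ 1#
    }

  ⟦⟧-equal? : ∀ i j → Maybe (⟦ i ⟧ ≈ ⟦ j ⟧)
  ⟦⟧-equal? i j with i ℤ.≟ j
  ... | yes ≡.refl = just refl
  ... | no _       = nothing

  open Algebra.Solver.Ring ℤ.+-*-rawRing (fromCommutativeRing R) homomorphism ⟦⟧-equal? public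
    using (solve; _:=_; _:+_; _:*_; :-_; _:-_; con)

module _ {f ℓ₁ ℓ₂ : Level} (F : OrderedField f ℓ₁ ℓ₂) where
  open OrderedField F
  open IsTotalOrder isTotalOrder using (total; antisym)
    renaming (reflexive to ≤-reflexive; trans to ≤-trans)
  open IntegerCoefficientSolver commutativeRing using (solve; _:=_; _:+_; _:*_; :-_; _:-_; con)
  open import Relation.Binary.Reasoning.Setoid setoid

  +-nonneg : ∀ {x y} → 0# ≤ x → 0# ≤ y → 0# ≤ x + y
  +-nonneg {x} {y} 0≤x 0≤y =
    ≤-trans 0≤y (≤-trans (≤-reflexive (sym (+-identityˡ y))) (+-mono-≤ y 0≤x))

  x≤y⇒0≤y-x : ∀ {x y} → x ≤ y → 0# ≤ y - x
  x≤y⇒0≤y-x {x} x≤y = ≤-trans (≤-reflexive (sym (-‿inverseʳ x))) (+-mono-≤ (- x) x≤y)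

  0≤y-x⇒x≤y : ∀ {x y} → 0# ≤ y - x → x ≤ y
  0≤y-x⇒x≤y {x} {y} 0≤y-x =
    ≤-trans (≤-reflexive (sym (+-identityˡ x))) (≤-trans (+-mono-≤ x 0≤y-x) (≤-reflexive y-x+x≈y))
    where
    y-x+x≈y : (y - x) + x ≈ y
    y-x+x≈y = solve 2 (λ x y → (y :- x) :+ x := y) refl x y

  x≤0⇒0≤-x : ∀ {x} → x ≤ 0# → 0# ≤ - x
  x≤0⇒0≤-x {x} x≤0 = ≤-trans (x≤y⇒0≤y-x x≤0) (≤-reflexive (+-identityˡ (- x)))

  *-cancelˡ-nonneg : ∀ {p x} → 0# < p → 0# ≤ p * x → 0# ≤ x
  *-cancelˡ-nonneg {p} {x} (0≤p , 0≉p) 0≤px with total 0# x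
  ... | inj₁ 0≤x = 0≤x
  ... | inj₂ x≤0 = ≤-reflexive (sym x≈0)
    where
    px≤0 : p * x ≤ 0#
    px≤0 = 0≤y-x⇒x≤y (≤-trans (*-nonneg 0≤p (x≤0⇒0≤-x x≤0)) (≤-reflexive p*-x≈0-px))
      where
      p*-x≈0-px : p * - x ≈ 0# - p * x
      p*-x≈0-px = solve 2 (λ p x → p :* (:- x) := con (+ 0) :- p :* x) refl p x
    p-invertible : Σ Carrier (λ q → p * q ≈ 1#)
    p-invertible = inverse p (λ p≈0 → 0≉p (sym p≈0))
    p⁻¹ : Carrier
    p⁻¹ = proj₁ p-invertible
    x≈0 : x ≈ 0#
    x≈0 = begin
      x               ≈⟨ *-identityˡ x ⟨
      1# * x          ≈⟨ *-congʳ (proj₂ p-invertible) ⟨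
      (p * p⁻¹) * x   ≈⟨ solve 3 (λ p q x → (p :* q) :* x := q :* (p :* x)) refl p p⁻¹ x ⟩
      p⁻¹ * (p * x)   ≈⟨ *-congˡ (antisym px≤0 0≤px) ⟩
      p⁻¹ * 0#        ≈⟨ zeroʳ p⁻¹ ⟩
      0#              ∎

  linear-casoratian : ∀ α₀ α₁ β₀ β₁ x →
    (α₁ * x + α₀) * (β₁ * (1# + x) + β₀) - (α₁ * (1# + x) + α₀) * (β₁ * x + β₀)
      ≈ α₀ * β₁ - α₁ * β₀
  linear-casoratian α₀ α₁ β₀ β₁ x = trans (solve 6 (λ α₀ α₁ β₀ β₁ one x →
    (α₁ :* x :+ α₀) :* (β₁ :* (one :+ x) :+ β₀) :- (α₁ :* (one :+ x) :+ α₀) :* (β₁ :* x :+ β₀)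
      := (α₀ :* β₁ :- α₁ :* β₀) :* one) refl α₀ α₁ β₀ β₁ 1# x)
    (*-identityʳ _)

  linear-cofactor-relation : ∀ α₀ α₁ β₀ β₁ γ₀ γ₁ x →
    (α₁ * x + α₀) * (β₀ * γ₁ - β₁ * γ₀) + (β₁ * x + β₀) * (γ₀ * α₁ - γ₁ * α₀)
      + (γ₁ * x + γ₀) * (α₀ * β₁ - α₁ * β₀) ≈ 0#
  linear-cofactor-relation = solve 7 (λ α₀ α₁ β₀ β₁ γ₀ γ₁ x →
    (α₁ :* x :+ α₀) :* (β₀ :* γ₁ :- β₁ :* γ₀) :+ (β₁ :* x :+ β₀) :* (γ₀ :* α₁ :- γ₁ :* α₀)
      :+ (γ₁ :* x :+ γ₀) :* (α₀ :* β₁ :- α₁ :* β₀) := con (+ 0)) refl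

  module ThreeTermRecurrence
    (z a b c : ℕ → Carrier) (A B C : Carrier)
    (z-pos : ∀ n → 0# < z n)
    (a-pos : ∀ m → 0# < a m)
    (c-nonneg : ∀ m → 0# ≤ c m)
    (recurrence : ∀ m → a m * z (suc (suc m)) ≈ b m * z (suc m) - c m * z m)
    (casoratian-ab : ∀ m → a m * b (suc m) - a (suc m) * b m ≈ C)
    (casoratian-ca : ∀ m → c m * a (suc m) - c (suc m) * a m ≈ B)
    (cofactor-relation : ∀ m → a m * A + b m * B + c m * C ≈ 0#)
    where

    Δ : ℕ → Carrier
    Δ m = z m * z (suc (suc m)) - z (suc m) * z (suc m)

    I : ℕ → Carrier
    I m = z m * B + z (suc m) * C

    Δ-recursion : ∀ m → a m * (a (suc m) * Δ (suc m)) ≈ z (suc (suc m)) * I m + a m * (c (suc m) * Δ m)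
    Δ-recursion m = begin
      a₀ * (a₁ * (v * y - w * w))
        ≈⟨ solve 5 (λ a₀ a₁ v w y → a₀ :* (a₁ :* (v :* y :- w :* w))
             := (a₀ :* v) :* (a₁ :* y) :- (a₁ :* w) :* (a₀ :* w)) refl a₀ a₁ v w y ⟩
      (a₀ * v) * (a₁ * y) - (a₁ * w) * (a₀ * w)
        ≈⟨ +-cong (*-congˡ (recurrence (suc m))) (-‿cong (*-congˡ (recurrence m))) ⟩
      (a₀ * v) * (b₁ * w - c₁ * v) - (a₁ * w) * (b₀ * v - c₀ * u)
        ≈⟨ solve 9 (λ a₀ b₀ c₀ a₁ b₁ c₁ u v w →
             (a₀ :* v) :* (b₁ :* w :- c₁ :* v) :- (a₁ :* w) :* (b₀ :* v :- c₀ :* u)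
             := w :* (u :* (c₀ :* a₁ :- c₁ :* a₀) :+ v :* (a₀ :* b₁ :- a₁ :* b₀))
                :+ a₀ :* (c₁ :* (u :* w :- v :* v))) refl a₀ b₀ c₀ a₁ b₁ c₁ u v w ⟩
      w * (u * (c₀ * a₁ - c₁ * a₀) + v * (a₀ * b₁ - a₁ * b₀)) + a₀ * (c₁ * (u * w - v * v))
        ≈⟨ +-congʳ (*-congˡ (+-cong (*-congˡ (casoratian-ca m)) (*-congˡ (casoratian-ab m)))) ⟩
      w * (u * B + v * C) + a₀ * (c₁ * (u * w - v * v)) ∎
      where
      a₀ b₀ c₀ a₁ b₁ c₁ u v w y : Carrier
      a₀ = a m; b₀ = b m; c₀ = c m; a₁ = a (suc m); b₁ = b (suc m); c₁ = c (suc m)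
      u = z m; v = z (suc m); w = z (suc (suc m)); y = z (suc (suc (suc m)))

    I-recursion : ∀ m → z m * I (suc m) ≈ z (suc m) * I m + C * Δ m
    I-recursion m = solve 5 (λ u v w B C → u :* (v :* B :+ w :* C)
      := v :* (u :* B :+ v :* C) :+ C :* (u :* w :- v :* v)) refl (z m) (z (suc m)) (z (suc (suc m))) B C

    I-recursion-cofactor : ∀ m → B * (a m * I (suc m)) ≈ z (suc m) * (a m * (B * B - A * C)) + (c m * - C) * I m
    I-recursion-cofactor m = begin
      B * (a₀ * (v * B + w * C))
        ≈⟨ solve 5 (λ a₀ v w B C → B :* (a₀ :* (v :* B :+ w :* C))
             := B :* (a₀ :* v :* B :+ C :* (a₀ :* w))) refl a₀ v w B C ⟩
      B * (a₀ * v * B + C * (a₀ * w))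
        ≈⟨ *-congˡ (+-congˡ (*-congˡ (recurrence m))) ⟩
      B * (a₀ * v * B + C * (b₀ * v - c₀ * u))
        ≈⟨ solve 8 (λ a₀ b₀ c₀ u v A B C →
             B :* (a₀ :* v :* B :+ C :* (b₀ :* v :- c₀ :* u))
             := v :* (a₀ :* (B :* B :- A :* C)) :+ (c₀ :* (:- C)) :* (u :* B :+ v :* C)
                :+ (v :* C) :* (a₀ :* A :+ b₀ :* B :+ c₀ :* C)) refl a₀ b₀ c₀ u v A B C ⟩
      v * (a₀ * (B * B - A * C)) + (c₀ * - C) * (u * B + v * C) + (v * C) * (a₀ * A + b₀ * B + c₀ * C)
        ≈⟨ +-congˡ (trans (*-congˡ (cofactor-relation m)) (zeroʳ (v * C))) ⟩
      v * (a₀ * (B * B - A * C)) + (c₀ * - C) * (u * B + v * C) + 0#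
        ≈⟨ +-identityʳ _ ⟩
      v * (a₀ * (B * B - A * C)) + (c₀ * - C) * (u * B + v * C) ∎
      where
      a₀ b₀ c₀ u v w : Carrier
      a₀ = a m; b₀ = b m; c₀ = c m
      u = z m; v = z (suc m); w = z (suc (suc m))

    Δ-nonneg-step : ∀ m → 0# ≤ Δ m → 0# ≤ I m → 0# ≤ Δ (suc m)
    Δ-nonneg-step m 0≤Δ 0≤I =
      *-cancelˡ-nonneg (a-pos (suc m)) (*-cancelˡ-nonneg (a-pos m)
        (≤-trans (+-nonneg (*-nonneg (proj₁ (z-pos (suc (suc m)))) 0≤I)
                           (*-nonneg (proj₁ (a-pos m)) (*-nonneg (c-nonneg (suc m)) 0≤Δ)))
                 (≤-reflexive (sym (Δ-recursion m)))))

    Regime : Set _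
    Regime = (0# ≤ C) ⊎ ((0# < B) × (C ≤ 0#) × (A * C ≤ B * B))

    I-nonneg-step : Regime → ∀ m → 0# ≤ Δ m → 0# ≤ I m → 0# ≤ I (suc m)
    I-nonneg-step (inj₁ 0≤C) m 0≤Δ 0≤I =
      *-cancelˡ-nonneg (z-pos m)
        (≤-trans (+-nonneg (*-nonneg (proj₁ (z-pos (suc m))) 0≤I) (*-nonneg 0≤C 0≤Δ))
                 (≤-reflexive (sym (I-recursion m))))
    I-nonneg-step (inj₂ (0<B , C≤0 , AC≤B²)) m _ 0≤I =
      *-cancelˡ-nonneg (a-pos m) (*-cancelˡ-nonneg 0<B
        (≤-trans (+-nonneg (*-nonneg (proj₁ (z-pos (suc m))) (*-nonneg (proj₁ (a-pos m)) (x≤y⇒0≤y-x AC≤B²)))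
                           (*-nonneg (*-nonneg (c-nonneg m) (x≤0⇒0≤-x C≤0)) 0≤I))
                 (≤-reflexive (sym (I-recursion-cofactor m)))))

    Δ-and-I-nonneg : Regime → 0# ≤ Δ 0 → 0# ≤ I 0 → ∀ m → 0# ≤ Δ m × 0# ≤ I m
    Δ-and-I-nonneg regime 0≤Δ₀ 0≤I₀ zero    = 0≤Δ₀ , 0≤I₀
    Δ-and-I-nonneg regime 0≤Δ₀ 0≤I₀ (suc m) =
      Δ-nonneg-step m 0≤Δ 0≤I , I-nonneg-step regime m 0≤Δ 0≤I
      where
      0≤Δ : 0# ≤ Δ m
      0≤Δ = proj₁ (Δ-and-I-nonneg regime 0≤Δ₀ 0≤I₀ m)
      0≤I : 0# ≤ I m
      0≤I = proj₂ (Δ-and-I-nonneg regime 0≤Δ₀ 0≤I₀ m)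

    logConvex : Regime → z 1 * z 1 ≤ z 0 * z 2 → 0# ≤ z 0 * B + z 1 * C → LogConvex z
    logConvex regime base 0≤I₀ m =
      0≤y-x⇒x≤y (proj₁ (Δ-and-I-nonneg regime (x≤y⇒0≤y-x base) 0≤I₀ m))

theorem3p10 : ∀ {c ℓ₁ ℓ₂ : Level} (F : OrderedField c ℓ₁ ℓ₂) →
  let open OrderedField F in
  (z : ℕ → Carrier) (α₀ α₁ β₀ β₁ γ₀ γ₁ : Carrier) →
  (∀ n → 0# < z n) →
  -- positivity of the coefficients for all n ≥ 1 (n = m+1)
  (∀ m → 0# < (α₁ * fromℕ (suc m) + α₀)) →
  (∀ m → 0# < (β₁ * fromℕ (suc m) + β₀)) →
  (∀ m → 0# < (γ₁ * fromℕ (suc m) + γ₀)) →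
  -- the recurrence for n ≥ 1 (n = m+1)
  (∀ m → ((α₁ * fromℕ (suc m) + α₀) * z (suc (suc m)))
         ≈ ((β₁ * fromℕ (suc m) + β₀) * z (suc m) - (γ₁ * fromℕ (suc m) + γ₀) * z m)) →
  (z 1 * z 1) ≤ (z 0 * z 2) →
  let A = β₀ * γ₁ - β₁ * γ₀
      B = γ₀ * α₁ - γ₁ * α₀
      C = α₀ * β₁ - α₁ * β₀
  in ((0# ≤ B) × (0# ≤ C))
     ⊎ ((B < 0#) × (0# < C) × ((B * B) ≤ (A * C)) × (0# ≤ (z 0 * B + z 1 * C)))
     ⊎ ((0# < B) × (C < 0#) × ((A * C) ≤ (B * B)) × (0# ≤ (z 0 * B + z 1 * C))) →
  LogConvex z
-- Positivity of the β-coefficients is never used, nor, in case (ii), are B < 0 and AC ≥ B²: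
-- C ≥ 0 alone propagates I.
theorem3p10 F z α₀ α₁ β₀ β₁ γ₀ γ₁ z-pos a-pos _ c-pos recurrence base cases = case cases of λ where
    (inj₁ (0≤B , 0≤C)) →
      logConvex (inj₁ 0≤C) base (+-nonneg F (*-nonneg (proj₁ (z-pos 0)) 0≤B) (*-nonneg (proj₁ (z-pos 1)) 0≤C))
    (inj₂ (inj₁ (_ , 0<C , _ , 0≤I₀))) →
      logConvex (inj₁ (proj₁ 0<C)) base 0≤I₀
    (inj₂ (inj₂ (0<B , C<0 , AC≤B² , 0≤I₀))) →
      logConvex (inj₂ (0<B , proj₁ C<0 , AC≤B²)) base 0≤I₀
  where
  open OrderedField F
  linear : Carrier → Carrier → ℕ → Carrier
  linear κ₀ κ₁ m = κ₁ * fromℕ (suc m) + κ₀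
  open ThreeTermRecurrence F z (linear α₀ α₁) (linear β₀ β₁) (linear γ₀ γ₁)
    (β₀ * γ₁ - β₁ * γ₀) (γ₀ * α₁ - γ₁ * α₀) (α₀ * β₁ - α₁ * β₀)
    z-pos a-pos (λ m → proj₁ (c-pos m)) recurrence
    (λ m → linear-casoratian F α₀ α₁ β₀ β₁ (fromℕ (suc m)))
    (λ m → linear-casoratian F γ₀ γ₁ α₀ α₁ (fromℕ (suc m)))
    (λ m → linear-cofactor-relation F α₀ α₁ β₀ β₁ γ₀ γ₁ (fromℕ (suc m)))
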